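{- Let $n$ be a positive integer multiple of $10$ and $\varepsilon\in(0,1/10)$. Let $\boldsymbol{u}=(1/n,\dots,1/n)\in\mathbb{R}^n$ and $\boldsymbol{v}=(1/n,\dots,1/n,1/5,2/5)\in\mathbb{R}^{2+2n/5}$, where $1/n$ appears $2n/5$ times in $\boldsymbol{v}$ (so $\|\boldsymbol{u}\|_1=\|\boldsymbol{v}\|_1=1$). Let $A$ be the $n\times(2+2n/5)$ matrix with $A_{ij}=0$ if ($i\le n/2$ and $j\le 2n/5$) or ($i>n/2$ and $j=2+2n/5$), and $A_{ij}=1$ otherwise. Then, with input $(A,(\boldsymbol{u},\boldsymbol{v}))$, SK takes $\Omega(\log n-\log\varepsilon)$ iterations to output a matrix $B$ satisfying $\|\boldsymbol{r}(B)-\boldsymbol{u}\|_1+\|\boldsymbol{c}(B)-\boldsymbol{v}\|_1\le\varepsilon$.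
   Context: SK on input $(A,(\boldsymbol{u},\boldsymbol{v}))$: $A^{(0)}_{ij}=u_iA_{ij}/r_i(A)$; odd $k$: $A^{(k)}_{ij}=v_jA^{(k-1)}_{ij}/c_j(A^{(k-1)})$; even $k\ge2$: $A^{(k)}_{ij}=u_iA^{(k-1)}_{ij}/r_i(A^{(k-1)})$, with $r_i,c_j$ row/column sums. "Takes $\Omega(T)$ iterations" means that the least $k$ for which $A^{(k)}$ satisfies the error bound is at least $cT$ for an absolute constant $c>0$.
   Formalization: The accuracy $\varepsilon\in(0,1/10)$ ranges over the rationals rather than the reals. -}

module Defs where

open import Data.Bool using (Bool; true; false; not; if_then_else_; _∨_; _∧_)
open import Data.Nat as ℕ using (ℕ; zero; suc; _<ᵇ_; _≡ᵇ_)
open import Data.Fin using (Fin; toℕ) renaming (zero to fzero; suc to fsuc)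
open import Data.Integer using (+_)
open import Data.Rational using (ℚ; 0ℚ; 1ℚ; _+_; _-_; _*_; ∣_∣; 1/_; ≢-nonZero; _/_)
open import Data.Rational.Properties using (_≟_)
open import Relation.Nullary using (yes; no)

Matrix : ℕ → ℕ → Set
Matrix m p = Fin m → Fin p → ℚ

sumFin : ∀ {n} → (Fin n → ℚ) → ℚ
sumFin {zero}  f = 0ℚ
sumFin {suc n} f = f fzero + sumFin (λ i → f (fsuc i))

-- Total division on ℚ (x / 0 := 0); only used where the divisor is nonzero.
divQ : ℚ → ℚ → ℚ
divQ x y with y ≟ 0ℚ
... | yes _  = 0ℚ
... | no y≢0 = x * (1/ y) {{≢-nonZero y≢0}}

rowSums : ∀ {m p} → Matrix m p → Fin m → ℚ
rowSums A i = sumFin (λ j → A i j)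

colSums : ∀ {m p} → Matrix m p → Fin p → ℚ
colSums A j = sumFin (λ i → A i j)

rowScale : ∀ {m p} → (Fin m → ℚ) → Matrix m p → Matrix m p
rowScale u A i j = divQ (u i * A i j) (rowSums A i)

colScale : ∀ {m p} → (Fin p → ℚ) → Matrix m p → Matrix m p
colScale v A i j = divQ (v j * A i j) (colSums A j)

odd : ℕ → Bool
odd zero    = false
odd (suc k) = not (odd k)

SK : ∀ {m p} → (Fin m → ℚ) → (Fin p → ℚ) → Matrix m p → ℕ → Matrix m p
SK u v A zero    = rowScale u A
SK u v A (suc k) =
  if odd (suc k) then colScale v (SK u v A k) else rowScale u (SK u v A k)

l1 : ∀ {n} → (Fin n → ℚ) → (Fin n → ℚ) → ℚ
l1 x y = sumFin (λ i → ∣ x i - y i ∣)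

skError : ∀ {m p} → (Fin m → ℚ) → (Fin p → ℚ) → Matrix m p → ℚ
skError u v B = l1 (rowSums B) u + l1 (colSums B) v

-- The instance, with n = 10 * (t + 1), so n/2 = 5(t+1), 2n/5 = 4(t+1),
-- and the number of columns is 2 + 2n/5 = 4(t+1) + 2.  Indices are 0-based:
-- (1-based) i ≤ n/2  ⟺  toℕ i < 5(t+1);  j ≤ 2n/5 ⟺ toℕ j < 4(t+1);
-- j = 2 + 2n/5 ⟺ toℕ j = 4(t+1) + 1.
nOf : ℕ → ℕ
nOf t = 10 ℕ.* suc t

colsOf : ℕ → ℕ
colsOf t = 4 ℕ.* suc t ℕ.+ 2

uVec : (t : ℕ) → Fin (nOf t) → ℚ
uVec t i = + 1 / nOf t

vVec : (t : ℕ) → Fin (colsOf t) → ℚ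
vVec t j =
  if toℕ j <ᵇ 4 ℕ.* suc t then + 1 / nOf t
  else if toℕ j ≡ᵇ 4 ℕ.* suc t then + 1 / 5
  else + 2 / 5

AMat : (t : ℕ) → Matrix (nOf t) (colsOf t)
AMat t i j =
  if ((toℕ i <ᵇ 5 ℕ.* suc t) ∧ (toℕ j <ᵇ 4 ℕ.* suc t))
     ∨ (not (toℕ i <ᵇ 5 ℕ.* suc t) ∧ (toℕ j ≡ᵇ 4 ℕ.* suc t ℕ.+ 1))
  then 0ℚ else 1ℚ

{-# OPTIONS --safe #-}
-- SK keeps A block-constant: rows split into the upper and lower halves, columns into the
-- 2n/5 columns with target 1/n and the two columns with targets 1/5 and 2/5.  After a row
-- scaling the iterate is determined by two numbers p > q, the share of the 1/5-column in an
-- upper and in a lower row, and a round of column and row scaling maps (p , q) to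
-- (p / (3p + 2q) , q / (3q + 2p)).  Starting from (1/2 , 1/(2n/5 + 1)), the ratio q / (p - q)
-- is O(1/n) and at most doubles per SK step.  On the other hand the error is at least
-- (p - q) / 10, and at least 1/10 unless q > 1/15.  So an error ε < 1/10 after k steps
-- forces 1/15 < q ≤ 2^(k+2) (p - q) / S ≤ 2^(k+2) 10 ε / S with S = 2n/5, i.e. n ≤ ε 2^(k+11).
module Submission where

open import Defs
open import Data.Nat using (ℕ; suc; _^_) renaming (_*_ to _*ℕ_)
open import Data.Product using (∃-syntax; _×_)
open import Data.Integer using (+_)
open import Data.Rational using (ℚ; 0ℚ; _≤_; _<_; _*_; _/_)

open import Algebra.Bundles using (CommutativeMonoid)
open import Data.Bool using (Bool; true; false; not; if_then_else_; _∧_; _∨_)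
open import Data.Empty using (⊥-elim)
open import Data.Fin using (Fin; toℕ) renaming (zero to fzero; suc to fsuc)
import Data.Fin.Properties as FinP
open import Data.List using (_∷_; [])
open import Data.Maybe using (Maybe; just; nothing)
open import Data.Nat using (zero; _<ᵇ_; _≡ᵇ_)
import Data.Nat as ℕ
import Data.Nat.Coprimality as Coprime
import Data.Nat.Properties as ℕ
import Data.Integer.Properties as ℤ
open import Data.Product using (_,_; proj₁; proj₂)
open import Data.Rational using (1ℚ; _+_; _-_; -_; ∣_∣; 1/_; mkℚ; ≢-nonZero; positive; nonNegative)
open import Data.Rational.Properties
  using (_≟_; _<?_; ≤-trans; <-trans; ≤-<-trans; <-≤-trans; <⇒≤; <-irrefl; ≤ᵇ⇒≤; positive⁻¹; ≰⇒>)
import Data.Rational.Properties as ℚ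
open import Data.Sum using (inj₁; inj₂)
open import Function using (case_of_)
open import Relation.Binary.Definitions using (tri<; tri≈; tri>)
open import Relation.Binary.PropositionalEquality
open import Relation.Nullary using (yes; no)
open import Relation.Nullary.Decidable using (True; toWitness; dec-true; dec-false)
open import Tactic.RingSolver using (solve; solve-∀)
open import Tactic.RingSolver.Core.AlmostCommutativeRing using (AlmostCommutativeRing; fromCommutativeRing)
open import Algebra.Properties.CommutativeSemigroup (CommutativeMonoid.commutativeSemigroup ℚ.*-1-commutativeMonoid)
  using (x∙yz≈y∙xz)

ℚ-ring : AlmostCommutativeRing _ _
ℚ-ring = fromCommutativeRing ℚ.+-*-commutativeRing isZero
  where
  isZero : ∀ x → Maybe (0ℚ ≡ x)
  isZero x with 0ℚ ≟ x
  ... | yes 0≡x = just 0≡x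
  ... | no _    = nothing

divQ-unique : ∀ {x y} z → y ≢ 0ℚ → x ≡ z * y → divQ x y ≡ z
divQ-unique {x} {y} z y≢0 x≡zy with y ≟ 0ℚ
... | yes y≡0 = ⊥-elim (y≢0 y≡0)
... | no  y≢0 = let instance _ = ≢-nonZero y≢0 in begin
  x * 1/ y       ≡⟨ cong (_* 1/ y) x≡zy ⟩
  z * y * 1/ y   ≡⟨ ℚ.*-assoc z y (1/ y) ⟩
  z * (y * 1/ y) ≡⟨ cong (z *_) (ℚ.*-inverseʳ y) ⟩
  z * 1ℚ         ≡⟨ ℚ.*-identityʳ z ⟩
  z              ∎
  where open ≡-Reasoning

divQ-*-cancelʳ : ∀ x {y} → y ≢ 0ℚ → divQ x y * y ≡ x
divQ-*-cancelʳ x {y} y≢0 with y ≟ 0ℚ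
... | yes y≡0 = ⊥-elim (y≢0 y≡0)
... | no  y≢0 = let instance _ = ≢-nonZero y≢0 in begin
  x * 1/ y * y   ≡⟨ ℚ.*-assoc x (1/ y) y ⟩
  x * (1/ y * y) ≡⟨ cong (x *_) (ℚ.*-inverseˡ y) ⟩
  x * 1ℚ         ≡⟨ ℚ.*-identityʳ x ⟩
  x              ∎
  where open ≡-Reasoning

*-cancelʳ-≡ : ∀ x z {y} → y ≢ 0ℚ → x * y ≡ z * y → x ≡ z
*-cancelʳ-≡ x z y≢0 xy≡zy =
  trans (sym (divQ-unique x y≢0 refl)) (divQ-unique z y≢0 xy≡zy)

divQ-zeroˡ : ∀ y → divQ 0ℚ y ≡ 0ℚ
divQ-zeroˡ y with y ≟ 0ℚ
... | yes _   = refl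
... | no  y≢0 = ℚ.*-zeroˡ ((1/ y) {{≢-nonZero y≢0}})

*-divQ-assoc : ∀ c x y → c * divQ x y ≡ divQ (c * x) y
*-divQ-assoc c x y with y ≟ 0ℚ
... | yes _ = ℚ.*-zeroʳ c
... | no  _ = sym (ℚ.*-assoc c x _)

*-divQ-unique : ∀ c {x y} z → y ≢ 0ℚ → c * x ≡ z * y → c * divQ x y ≡ z
*-divQ-unique c {x} {y} z y≢0 cx≡zy = trans (*-divQ-assoc c x y) (divQ-unique z y≢0 cx≡zy)

divQ-*-zero : ∀ c {x} y → x ≡ 0ℚ → divQ (c * x) y ≡ 0ℚ
divQ-*-zero c y refl = trans (cong (λ z → divQ z y) (ℚ.*-zeroʳ c)) (divQ-zeroˡ y)

divQ-complement : ∀ {x x' y} c → y ≢ 0ℚ → x + x' ≡ c * y → divQ x' y ≡ c - divQ x y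
divQ-complement {x} {x'} {y} c y≢0 x+x'≡cy = divQ-unique (c - divQ x y) y≢0 (begin
  x'                            ≡⟨ solve (x ∷ x' ∷ []) ℚ-ring ⟩
  x + x' - x                    ≡⟨ cong₂ _-_ x+x'≡cy (sym (divQ-*-cancelʳ x y≢0)) ⟩
  c * y - divQ x y * y          ≡⟨ *-distribʳ-- c (divQ x y) y ⟩
  (c - divQ x y) * y            ∎)
  where
  open ≡-Reasoning
  *-distribʳ-- : ∀ a b z → a * z - b * z ≡ (a - b) * z
  *-distribʳ-- = solve-∀ ℚ-ring

p+[q-p]≡q : ∀ p q → p + (q - p) ≡ q
p+[q-p]≡q = solve-∀ ℚ-ring

≤-from-difference : ∀ {p q} d → q - p ≡ d → 0ℚ ≤ d → p ≤ q
≤-from-difference {p} {q} d q-p≡d 0≤d =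
  subst₂ _≤_ (ℚ.+-identityʳ p) (p+[q-p]≡q p q) (ℚ.+-monoʳ-≤ p (subst (0ℚ ≤_) (sym q-p≡d) 0≤d))

<-from-difference : ∀ {p q} d → q - p ≡ d → 0ℚ < d → p < q
<-from-difference {p} {q} d q-p≡d 0<d =
  subst₂ _<_ (ℚ.+-identityʳ p) (p+[q-p]≡q p q) (ℚ.+-monoʳ-< p (subst (0ℚ <_) (sym q-p≡d) 0<d))

≤⇒0≤- : ∀ {p q} → p ≤ q → 0ℚ ≤ q - p
≤⇒0≤- {p} {q} p≤q = subst (_≤ q - p) (ℚ.+-inverseʳ p) (ℚ.+-monoˡ-≤ (- p) p≤q)

<⇒0<- : ∀ {p q} → p < q → 0ℚ < q - p
<⇒0<- {p} {q} p<q = subst (_< q - p) (ℚ.+-inverseʳ p) (ℚ.+-monoˡ-< (- p) p<q)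

+-nonNeg : ∀ {p q} → 0ℚ ≤ p → 0ℚ ≤ q → 0ℚ ≤ p + q
+-nonNeg = ℚ.+-mono-≤

+-pos : ∀ {p q} → 0ℚ < p → 0ℚ ≤ q → 0ℚ < p + q
+-pos = ℚ.+-mono-<-≤

*-nonNeg : ∀ {p q} → 0ℚ ≤ p → 0ℚ ≤ q → 0ℚ ≤ p * q
*-nonNeg {p} {q} 0≤p 0≤q =
  subst (_≤ p * q) (ℚ.*-zeroˡ q) (ℚ.*-monoʳ-≤-nonNeg q {{nonNegative 0≤q}} 0≤p)

*-pos : ∀ {p q} → 0ℚ < p → 0ℚ < q → 0ℚ < p * q
*-pos {p} {q} 0<p 0<q =
  subst (_< p * q) (ℚ.*-zeroˡ q) (ℚ.*-monoˡ-<-pos q {{positive 0<q}} 0<p)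

*-monoˡ-≤ : ∀ {r p q} → 0ℚ ≤ r → p ≤ q → r * p ≤ r * q
*-monoˡ-≤ {r} 0≤r = ℚ.*-monoˡ-≤-nonNeg r {{nonNegative 0≤r}}

*-monoʳ-≤ : ∀ {r p q} → 0ℚ ≤ r → p ≤ q → p * r ≤ q * r
*-monoʳ-≤ {r} 0≤r = ℚ.*-monoʳ-≤-nonNeg r {{nonNegative 0≤r}}

*-cancelˡ-≤ : ∀ {r p q} → 0ℚ < r → r * p ≤ r * q → p ≤ q
*-cancelˡ-≤ {r} 0<r = ℚ.*-cancelˡ-≤-pos r {{positive 0<r}}

*-cancelˡ-< : ∀ {r p q} → 0ℚ < r → r * p < r * q → p < q
*-cancelˡ-< {r} 0<r = ℚ.*-cancelˡ-<-nonNeg r {{nonNegative (<⇒≤ 0<r)}}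

pos⇒≢0 : ∀ {p} → 0ℚ < p → p ≢ 0ℚ
pos⇒≢0 0<p p≡0 = ℚ.<⇒≢ 0<p (sym p≡0)

≤-from-reciprocal : ∀ {n ν Y} → 0ℚ ≤ n → n * ν ≡ 1ℚ → 1ℚ ≤ Y * ν → n ≤ Y
≤-from-reciprocal {n} {ν} {Y} 0≤n nν≡1 1≤Yν = begin
  n              ≡⟨ sym (ℚ.*-identityʳ n) ⟩
  n * 1ℚ         ≤⟨ *-monoˡ-≤ 0≤n 1≤Yν ⟩
  n * (Y * ν)    ≡⟨ x∙yz≈y∙xz n Y ν ⟩
  Y * (n * ν)    ≡⟨ cong (Y *_) nν≡1 ⟩
  Y * 1ℚ         ≡⟨ ℚ.*-identityʳ Y ⟩
  Y              ∎
  where open ℚ.≤-Reasoning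

<-literal : ∀ p q → {True (p <? q)} → p < q
<-literal p q {p<q} = toWitness p<q

p≤∣p∣ : ∀ p → p ≤ ∣ p ∣
p≤∣p∣ p with ℚ.∣p∣≡p∨∣p∣≡-p p
... | inj₁ ∣p∣≡p  = ℚ.≤-reflexive (sym ∣p∣≡p)
... | inj₂ ∣p∣≡-p =
  ≤-trans (≤-from-difference (- p) (0-p≡-p p) (subst (0ℚ ≤_) ∣p∣≡-p (ℚ.0≤∣p∣ p))) (ℚ.0≤∣p∣ p)
  where
  0-p≡-p : ∀ p → 0ℚ - p ≡ - p
  0-p≡-p = solve-∀ ℚ-ring

-p≤∣p∣ : ∀ p → - p ≤ ∣ p ∣
-p≤∣p∣ p = subst (- p ≤_) (ℚ.∣-p∣≡∣p∣ p) (p≤∣p∣ (- p))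

∣p*q∣≡p*∣q∣ : ∀ {p} q → 0ℚ ≤ p → ∣ p * q ∣ ≡ p * ∣ q ∣
∣p*q∣≡p*∣q∣ {p} q 0≤p = trans (ℚ.∣p*q∣≡∣p∣*∣q∣ p q) (cong (_* ∣ q ∣) (ℚ.0≤p⇒∣p∣≡p 0≤p))

toℚ : ℕ → ℚ
toℚ m = + m / 1

toℚ-normal : ∀ m → toℚ m ≡ mkℚ (+ m) 0 (Coprime.sym (Coprime.1-coprimeTo m))
toℚ-normal m = ℚ.↥p/↧p≡p (mkℚ (+ m) 0 (Coprime.sym (Coprime.1-coprimeTo m)))

toℚ-+ : ∀ a b → toℚ (a ℕ.+ b) ≡ toℚ a + toℚ b
toℚ-+ a b rewrite toℚ-normal a | toℚ-normal b = ℚ./-cong {p₁ = + (a ℕ.+ b)}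
  (trans (ℤ.pos-+ a b) (sym (cong₂ Data.Integer._+_ (ℤ.*-identityʳ (+ a)) (ℤ.*-identityʳ (+ b))))) refl

toℚ-* : ∀ a b → toℚ (a *ℕ b) ≡ toℚ a * toℚ b
toℚ-* a b rewrite toℚ-normal a | toℚ-normal b = ℚ./-cong {p₁ = + (a *ℕ b)} (ℤ.pos-* a b) refl

toℚ-nonNeg : ∀ a → 0ℚ ≤ toℚ a
toℚ-nonNeg a rewrite toℚ-normal a = ℚ.nonNegative⁻¹ _

toℚ-mono-≤ : ∀ {a b} → a ℕ.≤ b → toℚ a ≤ toℚ b
toℚ-mono-≤ {a} {b} a≤b = subst₂ _≤_ (ℚ.+-identityʳ (toℚ a))
  (trans (sym (toℚ-+ a (b ℕ.∸ a))) (cong toℚ (ℕ.m+[n∸m]≡n a≤b)))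
  (ℚ.+-monoʳ-≤ (toℚ a) (toℚ-nonNeg (b ℕ.∸ a)))

375*2^[2+k]≤2^[11+k] : ∀ k → 375 *ℕ 2 ^ (2 ℕ.+ k) ℕ.≤ 2 ^ (11 ℕ.+ k)
375*2^[2+k]≤2^[11+k] k = subst (375 *ℕ 2 ^ (2 ℕ.+ k) ℕ.≤_) (sym (ℕ.^-distribˡ-+-* 2 9 (2 ℕ.+ k)))
  (ℕ.*-monoˡ-≤ (2 ^ (2 ℕ.+ k)) (ℕ.≤ᵇ⇒≤ 375 512 _))

12+k≤12*[1+k] : ∀ k → 12 ℕ.+ k ℕ.≤ 12 *ℕ suc k
12+k≤12*[1+k] k = subst (12 ℕ.+ k ℕ.≤_) (sym (ℕ.*-suc 12 k)) (ℕ.+-monoʳ-≤ 12 (ℕ.m≤n*m k 12))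

sumFin-cong : ∀ {n} {f g : Fin n → ℚ} → (∀ i → f i ≡ g i) → sumFin f ≡ sumFin g
sumFin-cong {zero}  f≗g = refl
sumFin-cong {suc n} f≗g = cong₂ _+_ (f≗g fzero) (sumFin-cong (λ i → f≗g (fsuc i)))

sumℕ : ℕ → (ℕ → ℚ) → ℚ
sumℕ zero    f = 0ℚ
sumℕ (suc n) f = f 0 + sumℕ n (λ i → f (suc i))

sumFin-toℕ : ∀ n (f : ℕ → ℚ) → sumFin {n} (λ i → f (toℕ i)) ≡ sumℕ n f
sumFin-toℕ zero    f = refl
sumFin-toℕ (suc n) f = cong (_+_ (f 0)) (sumFin-toℕ n (λ i → f (suc i)))

sumℕ-+ : ∀ m n f → sumℕ (m ℕ.+ n) f ≡ sumℕ m f + sumℕ n (λ i → f (m ℕ.+ i))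
sumℕ-+ zero    n f = sym (ℚ.+-identityˡ _)
sumℕ-+ (suc m) n f = trans (cong (_+_ (f 0)) (sumℕ-+ m n (λ i → f (suc i))))
  (sym (ℚ.+-assoc (f 0) _ _))

sumℕ-const : ∀ m {f x} → (∀ i → i ℕ.< m → f i ≡ x) → sumℕ m f ≡ toℚ m * x
sumℕ-const zero    {x = x} f≡x = sym (ℚ.*-zeroˡ x)
sumℕ-const (suc m) {f} {x} f≡x = begin
  f 0 + sumℕ m (λ i → f (suc i)) ≡⟨ cong₂ _+_ (f≡x 0 ℕ.z<s)
                                      (sumℕ-const m (λ i i<m → f≡x (suc i) (ℕ.s<s i<m))) ⟩
  x + toℚ m * x                  ≡⟨ cong (_+ toℚ m * x) (sym (ℚ.*-identityˡ x)) ⟩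
  1ℚ * x + toℚ m * x             ≡⟨ sym (ℚ.*-distribʳ-+ x 1ℚ (toℚ m)) ⟩
  (1ℚ + toℚ m) * x               ≡⟨ cong (_* x) (sym (toℚ-+ 1 m)) ⟩
  toℚ (suc m) * x                ∎
  where open ≡-Reasoning

-- Block-constant matrices

module Blockwise {R C : Set} (ΣR : (R → ℚ) → ℚ) (ΣC : (C → ℚ) → ℚ) (uᴮ : R → ℚ) (vᴮ : C → ℚ) where

  Block : Set
  Block = R → C → ℚ

  rowSumsᴮ : Block → R → ℚ
  rowSumsᴮ g r = ΣC (g r)

  colSumsᴮ : Block → C → ℚ
  colSumsᴮ g c = ΣR (λ r → g r c)

  rowScaleᴮ : Block → Block
  rowScaleᴮ g r c = divQ (uᴮ r * g r c) (rowSumsᴮ g r)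

  colScaleᴮ : Block → Block
  colScaleᴮ g r c = divQ (vᴮ c * g r c) (colSumsᴮ g c)

  SKᴮ : Block → ℕ → Block
  SKᴮ g zero    = rowScaleᴮ g
  SKᴮ g (suc k) = if odd (suc k) then colScaleᴮ (SKᴮ g k) else rowScaleᴮ (SKᴮ g k)

  skErrorᴮ : Block → ℚ
  skErrorᴮ g = ΣR (λ r → ∣ rowSumsᴮ g r - uᴮ r ∣) + ΣC (λ c → ∣ colSumsᴮ g c - vᴮ c ∣)

  module Expand {m p} (row : Fin m → R) (col : Fin p → C)
    (sum-rows : ∀ H → sumFin (λ i → H (row i)) ≡ ΣR H)
    (sum-cols : ∀ H → sumFin (λ j → H (col j)) ≡ ΣC H)
    {u : Fin m → ℚ} {v : Fin p → ℚ}
    (u≡uᴮ : ∀ i → u i ≡ uᴮ (row i)) (v≡vᴮ : ∀ j → v j ≡ vᴮ (col j)) where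

    record _≅_ (A : Matrix m p) (g : Block) : Set where
      constructor blockwise
      field entry : ∀ i j → A i j ≡ g (row i) (col j)
    open _≅_

    rowSums-≅ : ∀ {A g} → A ≅ g → ∀ i → rowSums A i ≡ rowSumsᴮ g (row i)
    rowSums-≅ {g = g} A≅g i = trans (sumFin-cong (entry A≅g i)) (sum-cols (g (row i)))

    colSums-≅ : ∀ {A g} → A ≅ g → ∀ j → colSums A j ≡ colSumsᴮ g (col j)
    colSums-≅ {g = g} A≅g j = trans (sumFin-cong (λ i → entry A≅g i j)) (sum-rows (λ r → g r (col j)))

    rowScale-≅ : ∀ {A g} → A ≅ g → rowScale u A ≅ rowScaleᴮ g
    rowScale-≅ A≅g = blockwise λ i j → cong₂ divQ (cong₂ _*_ (u≡uᴮ i) (entry A≅g i j)) (rowSums-≅ A≅g i)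

    colScale-≅ : ∀ {A g} → A ≅ g → colScale v A ≅ colScaleᴮ g
    colScale-≅ A≅g = blockwise λ i j → cong₂ divQ (cong₂ _*_ (v≡vᴮ j) (entry A≅g i j)) (colSums-≅ A≅g j)

    SK-≅ : ∀ {A g} → A ≅ g → ∀ k → SK u v A k ≅ SKᴮ g k
    SK-≅ A≅g zero    = rowScale-≅ A≅g
    SK-≅ A≅g (suc k) = scale-≅ (odd (suc k)) (SK-≅ A≅g k)
      where
      scale-≅ : ∀ b {B h} → B ≅ h →
        (if b then colScale v B else rowScale u B) ≅ (if b then colScaleᴮ h else rowScaleᴮ h)
      scale-≅ true  = colScale-≅
      scale-≅ false = rowScale-≅

    skError-≅ : ∀ {A g} → A ≅ g → skError u v A ≡ skErrorᴮ g
    skError-≅ {A} {g} A≅g = cong₂ _+_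
      (trans (sumFin-cong (λ i → cong₂ (λ a b → ∣ a - b ∣) (rowSums-≅ A≅g i) (u≡uᴮ i)))
             (sum-rows (λ r → ∣ rowSumsᴮ g r - uᴮ r ∣)))
      (trans (sumFin-cong (λ j → cong₂ (λ a b → ∣ a - b ∣) (colSums-≅ A≅g j) (v≡vᴮ j)))
             (sum-cols (λ c → ∣ colSumsᴮ g c - vᴮ c ∣)))

-- The recurrence (p , q) ↦ (p / (3p + 2q) , q / (3q + 2p))

record Admissible (p q : ℚ) : Set where
  field
    ⅕≤p : + 1 / 5 ≤ p
    p<1 : p < 1ℚ
    0<q : 0ℚ < q
    q<p : q < p

  0<p : 0ℚ < p
  0<p = <-trans 0<q q<p

  0<p+q : 0ℚ < p + q
  0<p+q = +-pos 0<p (<⇒≤ 0<q)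

weight : ℚ → ℚ → ℚ
weight a b = (+ 3 / 1) * a + (+ 2 / 1) * b

weight-pos : ∀ {a b} → 0ℚ < a → 0ℚ < b → 0ℚ < weight a b
weight-pos 0<a 0<b = +-pos (*-pos (positive⁻¹ (+ 3 / 1)) 0<a) (<⇒≤ (*-pos (positive⁻¹ (+ 2 / 1)) 0<b))

update : ℚ → ℚ → ℚ
update a b = divQ a (weight a b)

weight-*-update : ∀ {a b} → 0ℚ < a → 0ℚ < b → weight a b * update a b ≡ a
weight-*-update {a} {b} 0<a 0<b =
  trans (ℚ.*-comm (weight a b) _) (divQ-*-cancelʳ a (pos⇒≢0 (weight-pos 0<a 0<b)))

module _ {p q p' q' : ℚ} (adm : Admissible p q)
         (p'-spec : weight p q * p' ≡ p) (q'-spec : weight q p * q' ≡ q) where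
  open Admissible adm

  private
    0<w : 0ℚ < weight p q
    0<w = weight-pos 0<p 0<q
    0<w' : 0ℚ < weight q p
    0<w' = weight-pos 0<q 0<p

    scaled-difference : weight p q * weight q p * (p' - q') ≡ (+ 2 / 1) * (p - q) * (p + q)
    scaled-difference = begin
      weight p q * weight q p * (p' - q')                 ≡⟨ distrib (weight p q) (weight q p) p' q' ⟩
      weight q p * (weight p q * p') - weight p q * (weight q p * q')
        ≡⟨ cong₂ (λ a b → weight q p * a - weight p q * b) p'-spec q'-spec ⟩
      ((+ 3 / 1) * q + (+ 2 / 1) * p) * p - ((+ 3 / 1) * p + (+ 2 / 1) * q) * q
                                                          ≡⟨ solve (p ∷ q ∷ []) ℚ-ring ⟩
      (+ 2 / 1) * (p - q) * (p + q)                       ∎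
      where
      open ≡-Reasoning
      distrib : ∀ w w' x y → w * w' * (x - y) ≡ w' * (w * x) - w * (w' * y)
      distrib = solve-∀ ℚ-ring

    w≤5p : ((+ 3 / 1) * p + (+ 2 / 1) * q) * (+ 1 / 5) ≤ p
    w≤5p = ≤-from-difference ((+ 2 / 5) * (p - q)) (solve (p ∷ q ∷ []) ℚ-ring)
             (*-nonNeg (ℚ.nonNegative⁻¹ (+ 2 / 5)) (≤⇒0≤- (<⇒≤ q<p)))

    p<w : p < ((+ 3 / 1) * p + (+ 2 / 1) * q) * 1ℚ
    p<w = <-from-difference ((+ 2 / 1) * (p + q)) (solve (p ∷ q ∷ []) ℚ-ring)
            (*-pos (positive⁻¹ (+ 2 / 1)) 0<p+q)

  admissible-step : Admissible p' q'
  admissible-step = record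
    { ⅕≤p = *-cancelˡ-≤ 0<w (subst (_ ≤_) (sym p'-spec) w≤5p)
    ; p<1 = *-cancelˡ-< 0<w (subst (_< _) (sym p'-spec) p<w)
    ; 0<q = *-cancelˡ-< 0<w' (subst₂ _<_ (sym (ℚ.*-zeroʳ (weight q p))) (sym q'-spec) 0<q)
    ; q<p = <-from-difference (p' - q') refl (*-cancelˡ-< (*-pos 0<w 0<w')
              (subst₂ _<_ (sym (ℚ.*-zeroʳ (weight p q * weight q p))) (sym scaled-difference)
                (*-pos (*-pos (positive⁻¹ (+ 2 / 1)) (<⇒0<- q<p)) 0<p+q)))
    }

  -- q / (p - q) at most doubles
  ratio-step : ∀ c {X} → 0ℚ ≤ X → c * q ≤ (p - q) * X → c * q' ≤ (p' - q') * ((+ 2 / 1) * X)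
  ratio-step c {X} 0≤X cq≤[p-q]X = *-cancelˡ-≤ (*-pos 0<w 0<w') (begin
    weight p q * weight q p * (c * q')           ≡⟨ regroup (weight p q) (weight q p) c q' ⟩
    weight p q * (c * (weight q p * q'))         ≡⟨ cong (λ x → weight p q * (c * x)) q'-spec ⟩
    weight p q * (c * q)                         ≤⟨ *-monoˡ-≤ (<⇒≤ 0<w) cq≤[p-q]X ⟩
    ((+ 3 / 1) * p + (+ 2 / 1) * q) * ((p - q) * X)
                                                 ≤⟨ ≤-from-difference ((p - q) * X * (p + (+ 2 / 1) * q))
                                                      (solve (p ∷ q ∷ X ∷ []) ℚ-ring)
                                                      (*-nonNeg (*-nonNeg (≤⇒0≤- (<⇒≤ q<p)) 0≤X)
                                                        (+-nonNeg (<⇒≤ 0<p)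
                                                          (*-nonNeg (ℚ.nonNegative⁻¹ (+ 2 / 1)) (<⇒≤ 0<q)))) ⟩
    (+ 2 / 1) * (p - q) * (p + q) * ((+ 2 / 1) * X)
                                                 ≡⟨ cong (_* ((+ 2 / 1) * X)) (sym scaled-difference) ⟩
    weight p q * weight q p * (p' - q') * ((+ 2 / 1) * X)
                                                 ≡⟨ ℚ.*-assoc (weight p q * weight q p) (p' - q') ((+ 2 / 1) * X) ⟩
    weight p q * weight q p * ((p' - q') * ((+ 2 / 1) * X)) ∎)
    where
    open ℚ.≤-Reasoning
    regroup : ∀ w w' c x → w * w' * (c * x) ≡ w * (c * (w' * x))
    regroup = solve-∀ ℚ-ring

update-admissible : ∀ {p q} → Admissible p q → Admissible (update p q) (update q p)
update-admissible adm = admissible-step adm (weight-*-update 0<p 0<q) (weight-*-update 0<q 0<p)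
  where open Admissible adm

update-ratio : ∀ {p q} c {X} → Admissible p q → 0ℚ ≤ X → c * q ≤ (p - q) * X →
  c * update q p ≤ (update p q - update q p) * ((+ 2 / 1) * X)
update-ratio c adm = ratio-step adm (weight-*-update 0<p 0<q) (weight-*-update 0<q 0<p) c
  where open Admissible adm

-- Lower bounds for the error

record LowerBound (p q E : ℚ) : Set where
  constructor lowerBound
  field
    gap-bound     : (+ 1 / 10) * (p - q) ≤ E
    small-q-bound : q ≤ + 1 / 15 → + 1 / 10 ≤ E

LowerBound-mono : ∀ {p q E E'} → E ≤ E' → LowerBound p q E → LowerBound p q E'
LowerBound-mono E≤E' (lowerBound gap small-q) =
  lowerBound (≤-trans gap E≤E') (λ q≤ → ≤-trans (small-q q≤) E≤E')

column-error-bound : ∀ {p q} → q < p → LowerBound p q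
  (∣ (1ℚ - q) * (+ 1 / 2) - + 2 / 5 ∣ + ∣ (p + q) * (+ 1 / 2) - + 1 / 5 ∣ + ∣ (1ℚ - p) * (+ 1 / 2) - + 2 / 5 ∣)
column-error-bound {p} {q} q<p = lowerBound bound small-q-bound
  where
  open ℚ.≤-Reasoning
  a b c : ℚ
  a = (1ℚ - q) * (+ 1 / 2) - + 2 / 5
  b = (p + q) * (+ 1 / 2) - + 1 / 5
  c = (1ℚ - p) * (+ 1 / 2) - + 2 / 5

  bound : (+ 1 / 10) * (p - q) ≤ ∣ a ∣ + ∣ b ∣ + ∣ c ∣
  bound = begin
    (+ 1 / 10) * (p - q) ≤⟨ ≤-from-difference ((+ 2 / 5) * (p - q)) (solve (p ∷ q ∷ []) ℚ-ring)
                              (*-nonNeg (ℚ.nonNegative⁻¹ (+ 2 / 5)) (≤⇒0≤- (<⇒≤ q<p))) ⟩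
    ((1ℚ - q) * (+ 1 / 2) - + 2 / 5) + 0ℚ + - ((1ℚ - p) * (+ 1 / 2) - + 2 / 5)
                         ≤⟨ ℚ.+-mono-≤ (ℚ.+-mono-≤ (p≤∣p∣ a) (ℚ.0≤∣p∣ b)) (-p≤∣p∣ c) ⟩
    ∣ a ∣ + ∣ b ∣ + ∣ c ∣ ∎

  small-q-bound : q ≤ + 1 / 15 → + 1 / 10 ≤ ∣ a ∣ + ∣ b ∣ + ∣ c ∣
  small-q-bound q≤1/15 = begin
    + 1 / 10             ≤⟨ ≤-from-difference ((+ 1 / 15 - q) + + 1 / 30) (solve (p ∷ q ∷ []) ℚ-ring)
                              (+-nonNeg (≤⇒0≤- q≤1/15) (ℚ.nonNegative⁻¹ (+ 1 / 30))) ⟩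
    ((1ℚ - q) * (+ 1 / 2) - + 2 / 5) + - ((p + q) * (+ 1 / 2) - + 1 / 5) + - ((1ℚ - p) * (+ 1 / 2) - + 2 / 5)
                         ≤⟨ ℚ.+-mono-≤ (ℚ.+-mono-≤ (p≤∣p∣ a) (-p≤∣p∣ b)) (-p≤∣p∣ c) ⟩
    ∣ a ∣ + ∣ b ∣ + ∣ c ∣ ∎

row-error-bound : ∀ {p q a b} → Admissible p q → (p + q) * a ≡ p * (+ 1 / 5) → (p + q) * b ≡ q * (+ 1 / 5) →
  LowerBound p q (∣ a - + 1 / 10 ∣ + ∣ b - + 1 / 10 ∣)
row-error-bound {p} {q} {a} {b} adm [p+q]a≡p/5 [p+q]b≡q/5 =
  LowerBound-mono a-b≤error
    (lowerBound (*-cancelˡ-≤ 0<p+q bound) (λ q≤1/15 → *-cancelˡ-≤ 0<p+q (small-q-bound q≤1/15)))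
  where
  open Admissible adm
  open ℚ.≤-Reasoning

  a-b≤error : a - b ≤ ∣ a - + 1 / 10 ∣ + ∣ b - + 1 / 10 ∣
  a-b≤error = begin
    a - b                                       ≡⟨ solve (a ∷ b ∷ []) ℚ-ring ⟩
    (a - + 1 / 10) + - (b - + 1 / 10)           ≤⟨ ℚ.+-mono-≤ (p≤∣p∣ (a - + 1 / 10)) (-p≤∣p∣ (b - + 1 / 10)) ⟩
    ∣ a - + 1 / 10 ∣ + ∣ b - + 1 / 10 ∣         ∎

  [p+q][a-b] : (p + q) * (a - b) ≡ (p - q) * (+ 1 / 5)
  [p+q][a-b] = begin-equality
    (p + q) * (a - b)                           ≡⟨ solve (p ∷ q ∷ a ∷ b ∷ []) ℚ-ring ⟩
    (p + q) * a - (p + q) * b                   ≡⟨ cong₂ _-_ [p+q]a≡p/5 [p+q]b≡q/5 ⟩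
    p * (+ 1 / 5) - q * (+ 1 / 5)               ≡⟨ solve (p ∷ q ∷ []) ℚ-ring ⟩
    (p - q) * (+ 1 / 5)                         ∎

  bound : (p + q) * ((+ 1 / 10) * (p - q)) ≤ (p + q) * (a - b)
  bound = begin
    (p + q) * ((+ 1 / 10) * (p - q))            ≤⟨ ≤-from-difference ((+ 1 / 10) * (p - q) * ((1ℚ - p) + (1ℚ - q)))
                                                     (solve (p ∷ q ∷ []) ℚ-ring)
                                                     (*-nonNeg (*-nonNeg (ℚ.nonNegative⁻¹ (+ 1 / 10)) (≤⇒0≤- (<⇒≤ q<p)))
                                                       (+-nonNeg (≤⇒0≤- (<⇒≤ p<1)) (≤⇒0≤- (<⇒≤ (<-trans q<p p<1))))) ⟩
    (p - q) * (+ 1 / 5)                         ≡⟨ sym [p+q][a-b] ⟩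
    (p + q) * (a - b)                           ∎

  small-q-bound : q ≤ + 1 / 15 → (p + q) * (+ 1 / 10) ≤ (p + q) * (a - b)
  small-q-bound q≤1/15 = begin
    (p + q) * (+ 1 / 10)                        ≤⟨ ≤-from-difference ((+ 1 / 10) * ((p - + 1 / 5) + (+ 3 / 1) * (+ 1 / 15 - q)))
                                                     (solve (p ∷ q ∷ []) ℚ-ring)
                                                     (*-nonNeg (ℚ.nonNegative⁻¹ (+ 1 / 10))
                                                       (+-nonNeg (≤⇒0≤- ⅕≤p) (*-nonNeg (ℚ.nonNegative⁻¹ (+ 3 / 1)) (≤⇒0≤- q≤1/15)))) ⟩
    (p - q) * (+ 1 / 5)                         ≡⟨ sym [p+q][a-b] ⟩
    (p + q) * (a - b)                           ∎

-- SK on the blocks of the instance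

-- upper: rows i ≤ n/2; small: the 2n/5 columns with target 1/n; fifth and twoFifths: the
-- columns with targets 1/5 and 2/5.
data Half : Set where
  upper lower : Half

data Column : Set where
  small fifth twoFifths : Column

column : ℕ → ℕ → Column
column s x = if x <ᵇ s then small else if x ≡ᵇ s then fifth else twoFifths

A₀ : Half → Column → ℚ
A₀ upper small     = 0ℚ
A₀ upper fifth     = 1ℚ
A₀ upper twoFifths = 1ℚ
A₀ lower small     = 1ℚ
A₀ lower fifth     = 1ℚ
A₀ lower twoFifths = 0ℚ

-- ν = 1/n, N = n/2 and S = 2n/5; only the products Nν and Sν matter.
module Dynamics (ν N S : ℚ) (0<ν : 0ℚ < ν) (Nν≡½ : N * ν ≡ + 1 / 2) (Sν≡⅖ : S * ν ≡ + 2 / 5)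
                (4≤S : + 4 / 1 ≤ S) where

  vᴮ : Column → ℚ
  vᴮ small     = ν
  vᴮ fifth     = + 1 / 5
  vᴮ twoFifths = + 2 / 5

  vᴮ-column : ∀ s x → (if x <ᵇ s then ν else if x ≡ᵇ s then + 1 / 5 else + 2 / 5) ≡ vᴮ (column s x)
  vᴮ-column s x with x <ᵇ s | x ≡ᵇ s
  ... | true  | _     = refl
  ... | false | true  = refl
  ... | false | false = refl

  open Blockwise (λ H → N * H upper + N * H lower) (λ H → S * H small + H fifth + H twoFifths)
                 (λ _ → ν) vᴮ public

  0<S : 0ℚ < S
  0<S = <-≤-trans (positive⁻¹ (+ 4 / 1)) 4≤S

  0<N : 0ℚ < N
  0<N = *-cancelˡ-< 0<ν (subst₂ _<_ (sym (ℚ.*-zeroʳ ν)) (trans (sym Nν≡½) (ℚ.*-comm N ν))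
                          (positive⁻¹ (+ 1 / 2)))

  N*[x*ν] : ∀ x → N * (x * ν) ≡ x * (+ 1 / 2)
  N*[x*ν] x = begin
    N * (x * ν) ≡⟨ solve (N ∷ x ∷ ν ∷ []) ℚ-ring ⟩
    x * (N * ν) ≡⟨ cong (x *_) Nν≡½ ⟩
    x * (+ 1 / 2) ∎
    where open ≡-Reasoning

  record RowScaled (p q : ℚ) (g : Block) : Set where
    field
      upper-small     : g upper small ≡ 0ℚ
      upper-fifth     : g upper fifth ≡ p * ν
      upper-twoFifths : g upper twoFifths ≡ (1ℚ - p) * ν
      lower-small     : S * g lower small ≡ (1ℚ - q) * ν
      lower-fifth     : g lower fifth ≡ q * ν
      lower-twoFifths : g lower twoFifths ≡ 0ℚ

  record ColScaled (p q : ℚ) (g : Block) : Set where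
    field
      upper-small     : g upper small ≡ 0ℚ
      upper-fifth     : (p + q) * g upper fifth ≡ (+ 2 / 5) * p * ν
      upper-twoFifths : g upper twoFifths ≡ (+ 4 / 5) * ν
      lower-small     : S * g lower small ≡ (+ 4 / 5) * ν
      lower-fifth     : (p + q) * g lower fifth ≡ (+ 2 / 5) * q * ν
      lower-twoFifths : g lower twoFifths ≡ 0ℚ

  module _ {p q g} (shape : RowScaled p q g) where
    open RowScaled shape

    colSum-fifth : colSumsᴮ g fifth ≡ (p + q) * (+ 1 / 2)
    colSum-fifth = begin
      N * g upper fifth + N * g lower fifth     ≡⟨ cong₂ (λ a b → N * a + N * b) upper-fifth lower-fifth ⟩
      N * (p * ν) + N * (q * ν)                 ≡⟨ cong₂ _+_ (N*[x*ν] p) (N*[x*ν] q) ⟩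
      p * (+ 1 / 2) + q * (+ 1 / 2)             ≡⟨ sym (ℚ.*-distribʳ-+ (+ 1 / 2) p q) ⟩
      (p + q) * (+ 1 / 2)                       ∎
      where open ≡-Reasoning

    colSum-twoFifths : colSumsᴮ g twoFifths ≡ (1ℚ - p) * (+ 1 / 2)
    colSum-twoFifths = begin
      N * g upper twoFifths + N * g lower twoFifths ≡⟨ cong₂ (λ a b → N * a + N * b) upper-twoFifths lower-twoFifths ⟩
      N * ((1ℚ - p) * ν) + N * 0ℚ                   ≡⟨ cong₂ _+_ (N*[x*ν] (1ℚ - p)) (ℚ.*-zeroʳ N) ⟩
      (1ℚ - p) * (+ 1 / 2) + 0ℚ                     ≡⟨ ℚ.+-identityʳ ((1ℚ - p) * (+ 1 / 2)) ⟩
      (1ℚ - p) * (+ 1 / 2)                          ∎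
      where open ≡-Reasoning

    S*colSum-small : S * colSumsᴮ g small ≡ (1ℚ - q) * (+ 1 / 2)
    S*colSum-small = trans (cong (λ a → S * (N * a + N * g lower small)) upper-small) (S*[N*0+N*γ] lower-small)
      where
      S*[N*0+N*γ] : ∀ {γ} → S * γ ≡ (1ℚ - q) * ν → S * (N * 0ℚ + N * γ) ≡ (1ℚ - q) * (+ 1 / 2)
      S*[N*0+N*γ] {γ} Sγ≡[1-q]ν = begin
        S * (N * 0ℚ + N * γ) ≡⟨ solve (S ∷ N ∷ γ ∷ []) ℚ-ring ⟩
        N * (S * γ)          ≡⟨ cong (N *_) Sγ≡[1-q]ν ⟩
        N * ((1ℚ - q) * ν)   ≡⟨ N*[x*ν] (1ℚ - q) ⟩
        (1ℚ - q) * (+ 1 / 2) ∎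
        where open ≡-Reasoning

  colScale-RowScaled : ∀ {p q g} → Admissible p q → RowScaled p q g → ColScaled p q (colScaleᴮ g)
  colScale-RowScaled {p} {q} {g} adm shape = record
    { upper-small     = divQ-*-zero ν (colSumsᴮ g small) upper-small
    ; upper-fifth     = fifth-entry p upper-fifth
    ; upper-twoFifths = begin
        divQ ((+ 2 / 5) * g upper twoFifths) (colSumsᴮ g twoFifths)
          ≡⟨ cong₂ (λ a b → divQ ((+ 2 / 5) * a) b) upper-twoFifths (colSum-twoFifths shape) ⟩
        divQ ((+ 2 / 5) * ((1ℚ - p) * ν)) ((1ℚ - p) * (+ 1 / 2))
          ≡⟨ divQ-unique _ (pos⇒≢0 (*-pos (<⇒0<- p<1) (positive⁻¹ (+ 1 / 2)))) (solve (p ∷ ν ∷ []) ℚ-ring) ⟩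
        (+ 4 / 5) * ν ∎
    ; lower-small     = small-entry upper-small
        (*-cancelˡ-< 0<S (subst₂ _<_ (sym (ℚ.*-zeroʳ S)) (sym lower-small) (*-pos (<⇒0<- (<-trans q<p p<1)) 0<ν)))
    ; lower-fifth     = fifth-entry q lower-fifth
    ; lower-twoFifths = divQ-*-zero (+ 2 / 5) (colSumsᴮ g twoFifths) lower-twoFifths
    }
    where
    open ≡-Reasoning
    open Admissible adm
    open RowScaled shape

    small-entry : ∀ {x γ} → x ≡ 0ℚ → 0ℚ < γ → S * divQ (ν * γ) (N * x + N * γ) ≡ (+ 4 / 5) * ν
    small-entry {γ = γ} refl 0<γ = *-divQ-unique S ((+ 4 / 5) * ν) (pos⇒≢0 0<sum) (begin
      S * (ν * γ)                             ≡⟨ solve (S ∷ ν ∷ γ ∷ []) ℚ-ring ⟩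
      (S * ν) * γ                             ≡⟨ cong (_* γ) Sν≡⅖ ⟩
      (+ 2 / 5) * γ                           ≡⟨ solve (γ ∷ []) ℚ-ring ⟩
      (+ 4 / 5) * ((+ 1 / 2) * γ)             ≡⟨ cong (λ c → (+ 4 / 5) * (c * γ)) (sym Nν≡½) ⟩
      (+ 4 / 5) * ((N * ν) * γ)               ≡⟨ solve (N ∷ ν ∷ γ ∷ []) ℚ-ring ⟩
      (+ 4 / 5) * ν * (N * 0ℚ + N * γ)        ∎)
      where
      0<sum : 0ℚ < N * 0ℚ + N * γ
      0<sum = subst (0ℚ <_) (trans (sym (ℚ.+-identityˡ (N * γ))) (cong (_+ N * γ) (sym (ℚ.*-zeroʳ N))))
                (*-pos 0<N 0<γ)

    fifth-entry : ∀ {x} r → x ≡ r * ν → (p + q) * divQ ((+ 1 / 5) * x) (colSumsᴮ g fifth) ≡ (+ 2 / 5) * r * ν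
    fifth-entry r refl = begin
      (p + q) * divQ ((+ 1 / 5) * (r * ν)) (colSumsᴮ g fifth)
        ≡⟨ cong (λ y → (p + q) * divQ ((+ 1 / 5) * (r * ν)) y) (colSum-fifth shape) ⟩
      (p + q) * divQ ((+ 1 / 5) * (r * ν)) ((p + q) * (+ 1 / 2))
        ≡⟨ *-divQ-unique (p + q) _ (pos⇒≢0 (*-pos 0<p+q (positive⁻¹ (+ 1 / 2)))) (solve (p ∷ q ∷ r ∷ ν ∷ []) ℚ-ring) ⟩
      (+ 2 / 5) * r * ν ∎

  rowScale-row-entries : ∀ {a b x t R} → 0ℚ < a → 0ℚ < b → (a + b) * x ≡ (+ 2 / 5) * a * ν →
    R ≡ x + (+ 4 / 5) * ν → t ≡ ν * ((+ 4 / 5) * ν) →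
    divQ (ν * x) R ≡ update a b * ν × divQ t R ≡ (1ℚ - update a b) * ν
  rowScale-row-entries {a} {b} {x} {t} {R} 0<a 0<b [a+b]x≡⅖aν refl refl = fifth-entry , twoFifths-entry
    where
    open ≡-Reasoning
    0<a+b : 0ℚ < a + b
    0<a+b = +-pos 0<a (<⇒≤ 0<b)

    0<R : 0ℚ < x + (+ 4 / 5) * ν
    0<R = +-pos (*-cancelˡ-< 0<a+b (subst₂ _<_ (sym (ℚ.*-zeroʳ (a + b))) (sym [a+b]x≡⅖aν)
                  (*-pos (*-pos (positive⁻¹ (+ 2 / 5)) 0<a) 0<ν)))
                (<⇒≤ (*-pos (positive⁻¹ (+ 4 / 5)) 0<ν))

    fifth-unique : ∀ u → weight a b * u ≡ a → divQ (ν * x) (x + (+ 4 / 5) * ν) ≡ u * ν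
    fifth-unique u wu≡a = divQ-unique (u * ν) (pos⇒≢0 0<R)
      (*-cancelʳ-≡ (ν * x) (u * ν * (x + (+ 4 / 5) * ν)) (pos⇒≢0 (*-pos 0<a+b (weight-pos 0<a 0<b))) (begin
        ν * x * ((a + b) * ((+ 3 / 1) * a + (+ 2 / 1) * b))
          ≡⟨ solve (ν ∷ x ∷ a ∷ b ∷ []) ℚ-ring ⟩
        ((+ 3 / 1) * a + (+ 2 / 1) * b) * ν * ((a + b) * x)
          ≡⟨ cong (((+ 3 / 1) * a + (+ 2 / 1) * b) * ν *_) [a+b]x≡⅖aν ⟩
        ((+ 3 / 1) * a + (+ 2 / 1) * b) * ν * ((+ 2 / 5) * a * ν)
          ≡⟨ solve (ν ∷ a ∷ b ∷ []) ℚ-ring ⟩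
        a * ν * ((+ 2 / 5) * a * ν + (+ 4 / 5) * (a + b) * ν)
          ≡⟨ cong₂ (λ c y → c * ν * (y + (+ 4 / 5) * (a + b) * ν)) (sym wu≡a) (sym [a+b]x≡⅖aν) ⟩
        ((+ 3 / 1) * a + (+ 2 / 1) * b) * u * ν * ((a + b) * x + (+ 4 / 5) * (a + b) * ν)
          ≡⟨ solve (ν ∷ x ∷ a ∷ b ∷ u ∷ []) ℚ-ring ⟩
        u * ν * (x + (+ 4 / 5) * ν) * ((a + b) * ((+ 3 / 1) * a + (+ 2 / 1) * b)) ∎))

    fifth-entry : divQ (ν * x) (x + (+ 4 / 5) * ν) ≡ update a b * ν
    fifth-entry = fifth-unique (update a b) (weight-*-update 0<a 0<b)

    twoFifths-entry : divQ (ν * ((+ 4 / 5) * ν)) (x + (+ 4 / 5) * ν) ≡ (1ℚ - update a b) * ν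
    twoFifths-entry = begin
      divQ (ν * ((+ 4 / 5) * ν)) (x + (+ 4 / 5) * ν)
        ≡⟨ divQ-complement ν (pos⇒≢0 0<R) (sym (ℚ.*-distribˡ-+ ν x ((+ 4 / 5) * ν))) ⟩
      ν - divQ (ν * x) (x + (+ 4 / 5) * ν)
        ≡⟨ cong (_-_ ν) fifth-entry ⟩
      ν - update a b * ν
        ≡⟨ w-uw≡[1-u]w (update a b) ν ⟩
      (1ℚ - update a b) * ν ∎
      where
      w-uw≡[1-u]w : ∀ u w → w - u * w ≡ (1ℚ - u) * w
      w-uw≡[1-u]w = solve-∀ ℚ-ring

  module _ {p q h} (shape : ColScaled p q h) where
    open ColScaled shape

    rowSum-upper : rowSumsᴮ h upper ≡ h upper fifth + (+ 4 / 5) * ν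
    rowSum-upper = begin
      S * h upper small + h upper fifth + h upper twoFifths
        ≡⟨ cong₂ (λ a c → S * a + h upper fifth + c) upper-small upper-twoFifths ⟩
      S * 0ℚ + h upper fifth + (+ 4 / 5) * ν
        ≡⟨ cong (λ a → a + h upper fifth + (+ 4 / 5) * ν) (ℚ.*-zeroʳ S) ⟩
      0ℚ + h upper fifth + (+ 4 / 5) * ν
        ≡⟨ cong (_+ (+ 4 / 5) * ν) (ℚ.+-identityˡ (h upper fifth)) ⟩
      h upper fifth + (+ 4 / 5) * ν ∎
      where open ≡-Reasoning

    rowSum-lower : rowSumsᴮ h lower ≡ h lower fifth + (+ 4 / 5) * ν
    rowSum-lower = begin
      S * h lower small + h lower fifth + h lower twoFifths
        ≡⟨ cong₂ (λ a c → a + h lower fifth + c) lower-small lower-twoFifths ⟩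
      (+ 4 / 5) * ν + h lower fifth + 0ℚ
        ≡⟨ ℚ.+-identityʳ ((+ 4 / 5) * ν + h lower fifth) ⟩
      (+ 4 / 5) * ν + h lower fifth
        ≡⟨ ℚ.+-comm ((+ 4 / 5) * ν) (h lower fifth) ⟩
      h lower fifth + (+ 4 / 5) * ν ∎
      where open ≡-Reasoning

  rowScale-ColScaled : ∀ {p q h} → Admissible p q → ColScaled p q h →
    RowScaled (update p q) (update q p) (rowScaleᴮ h)
  rowScale-ColScaled {p} {q} {h} adm shape = record
    { upper-small     = divQ-*-zero ν (rowSumsᴮ h upper) upper-small
    ; upper-fifth     = proj₁ upper-row
    ; upper-twoFifths = proj₂ upper-row
    ; lower-small     = trans (*-divQ-assoc S (ν * h lower small) (rowSumsᴮ h lower)) (proj₂ lower-row)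
    ; lower-fifth     = proj₁ lower-row
    ; lower-twoFifths = divQ-*-zero ν (rowSumsᴮ h lower) lower-twoFifths
    }
    where
    open Admissible adm
    open ColScaled shape

    upper-row : divQ (ν * h upper fifth) (rowSumsᴮ h upper) ≡ update p q * ν
              × divQ (ν * h upper twoFifths) (rowSumsᴮ h upper) ≡ (1ℚ - update p q) * ν
    upper-row = rowScale-row-entries 0<p 0<q upper-fifth (rowSum-upper shape) (cong (ν *_) upper-twoFifths)

    lower-row : divQ (ν * h lower fifth) (rowSumsᴮ h lower) ≡ update q p * ν
              × divQ (S * (ν * h lower small)) (rowSumsᴮ h lower) ≡ (1ℚ - update q p) * ν
    lower-row = rowScale-row-entries 0<q 0<p (trans (cong (_* h lower fifth) (ℚ.+-comm q p)) lower-fifth)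
      (rowSum-lower shape)
      (trans (x∙yz≈y∙xz S ν (h lower small)) (cong (ν *_) lower-small))

  q₀ : ℚ
  q₀ = divQ 1ℚ (S + 1ℚ)

  0<S+1 : 0ℚ < S + 1ℚ
  0<S+1 = +-pos 0<S (ℚ.nonNegative⁻¹ 1ℚ)

  [S+1]q₀≡1 : (S + 1ℚ) * q₀ ≡ 1ℚ
  [S+1]q₀≡1 = trans (ℚ.*-comm (S + 1ℚ) q₀) (divQ-*-cancelʳ 1ℚ (pos⇒≢0 0<S+1))

  q₀≤⅕ : q₀ ≤ + 1 / 5
  q₀≤⅕ = *-cancelˡ-≤ 0<S+1 (subst (_≤ (S + 1ℚ) * (+ 1 / 5)) (sym [S+1]q₀≡1)
    (≤-from-difference ((+ 1 / 5) * (S - + 4 / 1)) (solve (S ∷ []) ℚ-ring)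
      (*-nonNeg (ℚ.nonNegative⁻¹ (+ 1 / 5)) (≤⇒0≤- 4≤S))))

  initial-admissible : Admissible (+ 1 / 2) q₀
  initial-admissible = record
    { ⅕≤p = ≤ᵇ⇒≤ _
    ; p<1 = <-literal (+ 1 / 2) 1ℚ
    ; 0<q = *-cancelˡ-< 0<S+1 (subst₂ _<_ (sym (ℚ.*-zeroʳ (S + 1ℚ))) (sym [S+1]q₀≡1) (positive⁻¹ 1ℚ))
    ; q<p = ≤-<-trans q₀≤⅕ (<-literal (+ 1 / 5) (+ 1 / 2))
    }

  initial-RowScaled : RowScaled (+ 1 / 2) q₀ (SKᴮ A₀ 0)
  initial-RowScaled = record
    { upper-small     = divQ-*-zero ν (rowSumsᴮ A₀ upper) refl
    ; upper-fifth     = upper-entry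
    ; upper-twoFifths = upper-entry
    ; lower-small     = *-divQ-unique S ((1ℚ - q₀) * ν) lower-sum≢0 (lower-small-entry [S+1]q₀≡1)
    ; lower-fifth     = divQ-unique (q₀ * ν) lower-sum≢0 (lower-fifth-entry [S+1]q₀≡1)
    ; lower-twoFifths = divQ-*-zero ν (rowSumsᴮ A₀ lower) refl
    }
    where
    upper-entry : divQ (ν * 1ℚ) (S * 0ℚ + 1ℚ + 1ℚ) ≡ (+ 1 / 2) * ν
    upper-entry = begin
      divQ (ν * 1ℚ) (S * 0ℚ + 1ℚ + 1ℚ)   ≡⟨ cong (divQ (ν * 1ℚ)) upper-sum ⟩
      divQ (ν * 1ℚ) (+ 2 / 1)            ≡⟨ divQ-unique {y = + 2 / 1} ((+ 1 / 2) * ν) (λ ()) (solve (ν ∷ []) ℚ-ring) ⟩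
      (+ 1 / 2) * ν                      ∎
      where
      open ≡-Reasoning
      upper-sum : S * 0ℚ + 1ℚ + 1ℚ ≡ + 2 / 1
      upper-sum = solve (S ∷ []) ℚ-ring

    lower-sum≢0 : S * 1ℚ + 1ℚ + 0ℚ ≢ 0ℚ
    lower-sum≢0 = pos⇒≢0 (subst (0ℚ <_) lower-sum 0<S+1)
      where
      lower-sum : S + 1ℚ ≡ S * 1ℚ + 1ℚ + 0ℚ
      lower-sum = solve (S ∷ []) ℚ-ring

    lower-small-entry : ∀ {q} → (S + 1ℚ) * q ≡ 1ℚ → S * (ν * 1ℚ) ≡ (1ℚ - q) * ν * (S * 1ℚ + 1ℚ + 0ℚ)
    lower-small-entry {q} [S+1]q≡1 = begin
      S * (ν * 1ℚ)                          ≡⟨ solve (S ∷ ν ∷ []) ℚ-ring ⟩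
      ν * (S + 1ℚ) - ν * 1ℚ                 ≡⟨ cong (λ x → ν * (S + 1ℚ) - ν * x) (sym [S+1]q≡1) ⟩
      ν * (S + 1ℚ) - ν * ((S + 1ℚ) * q)     ≡⟨ solve (S ∷ ν ∷ q ∷ []) ℚ-ring ⟩
      (1ℚ - q) * ν * (S * 1ℚ + 1ℚ + 0ℚ)     ∎
      where open ≡-Reasoning

    lower-fifth-entry : ∀ {q} → (S + 1ℚ) * q ≡ 1ℚ → ν * 1ℚ ≡ q * ν * (S * 1ℚ + 1ℚ + 0ℚ)
    lower-fifth-entry {q} [S+1]q≡1 = begin
      ν * 1ℚ                                ≡⟨ cong (ν *_) (sym [S+1]q≡1) ⟩
      ν * ((S + 1ℚ) * q)                    ≡⟨ solve (S ∷ ν ∷ q ∷ []) ℚ-ring ⟩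
      q * ν * (S * 1ℚ + 1ℚ + 0ℚ)            ∎
      where open ≡-Reasoning

  initial-ratio : ∀ {q} → (S + 1ℚ) * q ≡ 1ℚ → q ≤ + 1 / 5 → S * q ≤ (+ 1 / 2 - q) * toℚ 4
  initial-ratio {q} [S+1]q≡1 q≤⅕ = begin
    S * q                 ≡⟨ solve (S ∷ q ∷ []) ℚ-ring ⟩
    (S + 1ℚ) * q - q      ≡⟨ cong (_- q) [S+1]q≡1 ⟩
    1ℚ - q                ≤⟨ ≤-from-difference ((+ 3 / 1) * (+ 1 / 5 - q) + + 2 / 5) (solve (q ∷ []) ℚ-ring)
                             (+-nonNeg (*-nonNeg (ℚ.nonNegative⁻¹ (+ 3 / 1)) (≤⇒0≤- q≤⅕)) (ℚ.nonNegative⁻¹ (+ 2 / 5))) ⟩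
    (+ 1 / 2 - q) * toℚ 4 ∎
    where open ℚ.≤-Reasoning

  Shape : Bool → ℚ → ℚ → Block → Set
  Shape false = RowScaled
  Shape true  = ColScaled

  record Stage (b : Bool) (X : ℕ) (g : Block) : Set where
    field
      p q        : ℚ
      admissible : Admissible p q
      ratio      : S * q ≤ (p - q) * toℚ X
      shape      : Shape b p q g

  stage-step : ∀ b {X g} → Stage b X g →
    Stage (not b) (2 *ℕ X) (if not b then colScaleᴮ g else rowScaleᴮ g)
  stage-step false {X} st = record
    { p          = p
    ; q          = q
    ; admissible = admissible
    ; ratio      = ≤-trans ratio (*-monoˡ-≤ (≤⇒0≤- (<⇒≤ q<p)) (toℚ-mono-≤ (ℕ.m≤n*m X 2)))
    ; shape      = colScale-RowScaled admissible shape
    }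
    where
    open Stage st
    open Admissible admissible
  stage-step true {X} st = record
    { p          = update p q
    ; q          = update q p
    ; admissible = update-admissible admissible
    ; ratio      = subst (λ Y → S * update q p ≤ (update p q - update q p) * Y) (sym (toℚ-* 2 X))
                     (update-ratio S admissible (toℚ-nonNeg X) ratio)
    ; shape      = rowScale-ColScaled admissible shape
    }
    where open Stage st

  stage : ∀ k → Stage (odd k) (2 ^ (2 ℕ.+ k)) (SKᴮ A₀ k)
  stage zero = record
    { p          = + 1 / 2
    ; q          = q₀
    ; admissible = initial-admissible
    ; ratio      = initial-ratio [S+1]q₀≡1 q₀≤⅕
    ; shape      = initial-RowScaled
    }
  stage (suc k) = stage-step (odd k) (stage k)

  rowErrors : Block → ℚ
  rowErrors g = N * ∣ rowSumsᴮ g upper - ν ∣ + N * ∣ rowSumsᴮ g lower - ν ∣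

  colErrors : Block → ℚ
  colErrors g = S * ∣ colSumsᴮ g small - ν ∣ + ∣ colSumsᴮ g fifth - + 1 / 5 ∣ + ∣ colSumsᴮ g twoFifths - + 2 / 5 ∣

  rowErrors-nonNeg : ∀ g → 0ℚ ≤ rowErrors g
  rowErrors-nonNeg g = +-nonNeg (*-nonNeg (<⇒≤ 0<N) (ℚ.0≤∣p∣ _)) (*-nonNeg (<⇒≤ 0<N) (ℚ.0≤∣p∣ _))

  colErrors-nonNeg : ∀ g → 0ℚ ≤ colErrors g
  colErrors-nonNeg g = +-nonNeg (+-nonNeg (*-nonNeg (<⇒≤ 0<S) (ℚ.0≤∣p∣ _)) (ℚ.0≤∣p∣ _)) (ℚ.0≤∣p∣ _)

  skErrorᴮ-nonNeg : ∀ g → 0ℚ ≤ skErrorᴮ g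
  skErrorᴮ-nonNeg g = +-nonNeg (rowErrors-nonNeg g) (colErrors-nonNeg g)

  colErrors≤skErrorᴮ : ∀ g → colErrors g ≤ skErrorᴮ g
  colErrors≤skErrorᴮ g = subst (_≤ skErrorᴮ g) (ℚ.+-identityˡ (colErrors g))
    (ℚ.+-monoˡ-≤ (colErrors g) (rowErrors-nonNeg g))

  rowErrors≤skErrorᴮ : ∀ g → rowErrors g ≤ skErrorᴮ g
  rowErrors≤skErrorᴮ g = subst (_≤ skErrorᴮ g) (ℚ.+-identityʳ (rowErrors g))
    (ℚ.+-monoʳ-≤ (rowErrors g) (colErrors-nonNeg g))

  colErrors-RowScaled : ∀ {p q g} → RowScaled p q g → colErrors g ≡
    ∣ (1ℚ - q) * (+ 1 / 2) - + 2 / 5 ∣ + ∣ (p + q) * (+ 1 / 2) - + 1 / 5 ∣ + ∣ (1ℚ - p) * (+ 1 / 2) - + 2 / 5 ∣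
  colErrors-RowScaled {p} {q} {g} shape = cong₂ _+_
    (cong₂ _+_ small-error (cong (λ c → ∣ c - + 1 / 5 ∣) (colSum-fifth shape)))
    (cong (λ c → ∣ c - + 2 / 5 ∣) (colSum-twoFifths shape))
    where
    open ≡-Reasoning
    S*[c-ν] : ∀ c → S * (c - ν) ≡ S * c - S * ν
    S*[c-ν] c = solve (S ∷ c ∷ ν ∷ []) ℚ-ring

    small-error : S * ∣ colSumsᴮ g small - ν ∣ ≡ ∣ (1ℚ - q) * (+ 1 / 2) - + 2 / 5 ∣
    small-error = begin
      S * ∣ colSumsᴮ g small - ν ∣       ≡⟨ sym (∣p*q∣≡p*∣q∣ (colSumsᴮ g small - ν) (<⇒≤ 0<S)) ⟩
      ∣ S * (colSumsᴮ g small - ν) ∣     ≡⟨ cong ∣_∣ (S*[c-ν] (colSumsᴮ g small)) ⟩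
      ∣ S * colSumsᴮ g small - S * ν ∣   ≡⟨ cong₂ (λ a b → ∣ a - b ∣) (S*colSum-small shape) Sν≡⅖ ⟩
      ∣ (1ℚ - q) * (+ 1 / 2) - + 2 / 5 ∣ ∎

  rowErrors-ColScaled : ∀ {p q h} → ColScaled p q h →
    rowErrors h ≡ ∣ N * h upper fifth - + 1 / 10 ∣ + ∣ N * h lower fifth - + 1 / 10 ∣
  rowErrors-ColScaled shape = cong₂ _+_
    (trans (cong (λ R → N * ∣ R - ν ∣) (rowSum-upper shape)) (row-error _))
    (trans (cong (λ R → N * ∣ R - ν ∣) (rowSum-lower shape)) (row-error _))
    where
    open ≡-Reasoning
    row-error : ∀ x → N * ∣ x + (+ 4 / 5) * ν - ν ∣ ≡ ∣ N * x - + 1 / 10 ∣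
    row-error x = begin
      N * ∣ x + (+ 4 / 5) * ν - ν ∣    ≡⟨ sym (∣p*q∣≡p*∣q∣ (x + (+ 4 / 5) * ν - ν) (<⇒≤ 0<N)) ⟩
      ∣ N * (x + (+ 4 / 5) * ν - ν) ∣  ≡⟨ cong ∣_∣ (solve (N ∷ x ∷ ν ∷ []) ℚ-ring) ⟩
      ∣ N * x - (+ 1 / 5) * (N * ν) ∣  ≡⟨ cong (λ c → ∣ N * x - (+ 1 / 5) * c ∣) Nν≡½ ⟩
      ∣ N * x - + 1 / 10 ∣             ∎

  RowScaled-error : ∀ {p q g} → Admissible p q → RowScaled p q g → LowerBound p q (skErrorᴮ g)
  RowScaled-error {g = g} adm shape = LowerBound-mono
    (subst (_≤ skErrorᴮ g) (colErrors-RowScaled shape) (colErrors≤skErrorᴮ g))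
    (column-error-bound (Admissible.q<p adm))

  ColScaled-error : ∀ {p q h} → Admissible p q → ColScaled p q h → LowerBound p q (skErrorᴮ h)
  ColScaled-error {p} {q} {h} adm shape = LowerBound-mono
    (subst (_≤ skErrorᴮ h) (rowErrors-ColScaled shape) (rowErrors≤skErrorᴮ h))
    (row-error-bound adm (scaled {r = p} upper-fifth) (scaled {r = q} lower-fifth))
    where
    open ColScaled shape
    scaled : ∀ {x r} → (p + q) * x ≡ (+ 2 / 5) * r * ν → (p + q) * (N * x) ≡ r * (+ 1 / 5)
    scaled {x} {r} [p+q]x≡⅖rν = begin
      (p + q) * (N * x)          ≡⟨ x∙yz≈y∙xz (p + q) N x ⟩
      N * ((p + q) * x)          ≡⟨ cong (N *_) [p+q]x≡⅖rν ⟩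
      N * ((+ 2 / 5) * r * ν)    ≡⟨ solve (N ∷ r ∷ ν ∷ []) ℚ-ring ⟩
      (+ 2 / 5) * r * (N * ν)    ≡⟨ cong ((+ 2 / 5) * r *_) Nν≡½ ⟩
      (+ 2 / 5) * r * (+ 1 / 2)  ≡⟨ solve (r ∷ []) ℚ-ring ⟩
      r * (+ 1 / 5)              ∎
      where open ≡-Reasoning

  Shape-error : ∀ b {p q g} → Admissible p q → Shape b p q g → LowerBound p q (skErrorᴮ g)
  Shape-error false = RowScaled-error
  Shape-error true  = ColScaled-error

  initial-error : + 1 / 10 ≤ skErrorᴮ (SKᴮ A₀ 0)
  initial-error = begin
    + 1 / 10                  ≤⟨ ≤ᵇ⇒≤ _ ⟩
    c                         ≤⟨ subst (_≤ a + b + c) (ℚ.+-identityˡ c) (ℚ.+-monoˡ-≤ c (+-nonNeg 0≤a 0≤b)) ⟩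
    a + b + c                 ≡⟨ sym (colErrors-RowScaled initial-RowScaled) ⟩
    colErrors (SKᴮ A₀ 0)      ≤⟨ colErrors≤skErrorᴮ (SKᴮ A₀ 0) ⟩
    skErrorᴮ (SKᴮ A₀ 0)       ∎
    where
    open ℚ.≤-Reasoning
    a b c : ℚ
    a = ∣ (1ℚ - q₀) * (+ 1 / 2) - + 2 / 5 ∣
    b = ∣ (+ 1 / 2 + q₀) * (+ 1 / 2) - + 1 / 5 ∣
    c = ∣ (1ℚ - + 1 / 2) * (+ 1 / 2) - + 2 / 5 ∣
    0≤a : 0ℚ ≤ a
    0≤a = ℚ.0≤∣p∣ ((1ℚ - q₀) * (+ 1 / 2) - + 2 / 5)
    0≤b : 0ℚ ≤ b
    0≤b = ℚ.0≤∣p∣ ((+ 1 / 2 + q₀) * (+ 1 / 2) - + 1 / 5)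

  error-forces-size : ∀ {p q E ε X} → Admissible p q → LowerBound p q E → E ≤ ε → ε < + 1 / 10 →
    0ℚ ≤ X → S * q ≤ (p - q) * X → 1ℚ ≤ ε * ((+ 375 / 1) * X) * ν
  error-forces-size {p} {q} {E} {ε} {X} adm (lowerBound gap small-q) E≤ε ε<⅒ 0≤X Sq≤[p-q]X = begin
    1ℚ                                      ≡⟨ cong ((+ 5 / 2) *_) (sym Sν≡⅖) ⟩
    (+ 5 / 2) * (S * ν)                     ≤⟨ *-monoˡ-≤ (ℚ.nonNegative⁻¹ (+ 5 / 2)) (*-monoʳ-≤ (<⇒≤ 0<ν) S≤150εX) ⟩
    (+ 5 / 2) * ((+ 150 / 1) * ε * X * ν)   ≡⟨ solve (ε ∷ X ∷ ν ∷ []) ℚ-ring ⟩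
    ε * ((+ 375 / 1) * X) * ν               ∎
    where
    open ℚ.≤-Reasoning
    open Admissible adm

    ⅟15<q : + 1 / 15 < q
    ⅟15<q = ≰⇒> (λ q≤⅟15 → <-irrefl refl (≤-<-trans (≤-trans (small-q q≤⅟15) E≤ε) ε<⅒))

    p-q≤10ε : p - q ≤ (+ 10 / 1) * ε
    p-q≤10ε = *-cancelˡ-≤ (positive⁻¹ (+ 1 / 10))
      (≤-trans gap (≤-trans E≤ε (ℚ.≤-reflexive (solve (ε ∷ []) ℚ-ring))))

    S≤150εX : S ≤ (+ 150 / 1) * ε * X
    S≤150εX = *-cancelˡ-≤ (positive⁻¹ (+ 1 / 15)) (begin
      (+ 1 / 15) * S                        ≡⟨ ℚ.*-comm (+ 1 / 15) S ⟩
      S * (+ 1 / 15)                        ≤⟨ *-monoˡ-≤ (<⇒≤ 0<S) (<⇒≤ ⅟15<q) ⟩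
      S * q                                 ≤⟨ Sq≤[p-q]X ⟩
      (p - q) * X                           ≤⟨ *-monoʳ-≤ 0≤X p-q≤10ε ⟩
      (+ 10 / 1) * ε * X                    ≡⟨ solve (ε ∷ X ∷ []) ℚ-ring ⟩
      (+ 1 / 15) * ((+ 150 / 1) * ε * X)    ∎)

  SKᴮ-error-bound : ∀ k {ε} → ε < + 1 / 10 → skErrorᴮ (SKᴮ A₀ k) ≤ ε → 1ℚ ≤ ε * toℚ (2 ^ (11 ℕ.+ k)) * ν
  SKᴮ-error-bound k {ε} ε<⅒ E≤ε = begin
    1ℚ                                          ≤⟨ error-forces-size admissible (Shape-error (odd k) admissible shape)
                                                     E≤ε ε<⅒ (toℚ-nonNeg (2 ^ (2 ℕ.+ k))) ratio ⟩
    ε * ((+ 375 / 1) * toℚ (2 ^ (2 ℕ.+ k))) * ν ≡⟨ cong (λ x → ε * x * ν) (sym (toℚ-* 375 (2 ^ (2 ℕ.+ k)))) ⟩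
    ε * toℚ (375 *ℕ 2 ^ (2 ℕ.+ k)) * ν          ≤⟨ *-monoʳ-≤ (<⇒≤ 0<ν)
                                                     (*-monoˡ-≤ (≤-trans (skErrorᴮ-nonNeg (SKᴮ A₀ k)) E≤ε)
                                                       (toℚ-mono-≤ (375*2^[2+k]≤2^[11+k] k))) ⟩
    ε * toℚ (2 ^ (11 ℕ.+ k)) * ν                ∎
    where
    open ℚ.≤-Reasoning
    open Stage (stage k)

-- The instance is block-constant

half : ℕ → ℕ → Half
half m x = if x <ᵇ m then upper else lower

half-upper : ∀ {m x} → x ℕ.< m → half m x ≡ upper
half-upper {m} {x} x<m rewrite dec-true (x ℕ.<? m) x<m = refl

half-lower : ∀ m i → half m (m ℕ.+ i) ≡ lower
half-lower m i rewrite dec-false (m ℕ.+ i ℕ.<? m) (ℕ.m+n≮m m i) = refl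

data ColumnIndex (s : ℕ) : ℕ → Set where
  small-index     : ∀ {x} → x ℕ.< s → ColumnIndex s x
  fifth-index     : ColumnIndex s (s ℕ.+ 0)
  twoFifths-index : ColumnIndex s (s ℕ.+ 1)

columnIndex : ∀ s {x} → x ℕ.< s ℕ.+ 2 → ColumnIndex s x
columnIndex s {x} x<s+2 with ℕ.<-cmp x s
... | tri< x<s _ _ = small-index x<s
... | tri≈ _ refl _ = subst (ColumnIndex x) (ℕ.+-identityʳ x) fifth-index
... | tri> _ _ s<x = subst (ColumnIndex s) (ℕ.≤-antisym s+1≤x x≤s+1) twoFifths-index
  where
  s+1≤x : s ℕ.+ 1 ℕ.≤ x
  s+1≤x = subst (ℕ._≤ x) (ℕ.+-comm 1 s) s<x
  x≤s+1 : x ℕ.≤ s ℕ.+ 1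
  x≤s+1 = ℕ.≤-pred (subst (suc x ℕ.≤_) (ℕ.+-suc s 1) x<s+2)

column-small : ∀ {s x} → x ℕ.< s → column s x ≡ small
column-small {s} {x} x<s rewrite dec-true (x ℕ.<? s) x<s = refl

column-fifth : ∀ s → column s (s ℕ.+ 0) ≡ fifth
column-fifth s rewrite dec-false (s ℕ.+ 0 ℕ.<? s) (ℕ.m+n≮m s 0)
                     | dec-true (s ℕ.+ 0 ℕ.≟ s) (ℕ.+-identityʳ s) = refl

column-twoFifths : ∀ s → column s (s ℕ.+ 1) ≡ twoFifths
column-twoFifths s rewrite dec-false (s ℕ.+ 1 ℕ.<? s) (ℕ.m+n≮m s 1)
                         | dec-false (s ℕ.+ 1 ℕ.≟ s) (ℕ.m+1+n≢m s) = refl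

A₀-pattern : ∀ r s {x} → x ℕ.< s ℕ.+ 2 →
  (if (r ∧ (x <ᵇ s)) ∨ (not r ∧ (x ≡ᵇ s ℕ.+ 1)) then 0ℚ else 1ℚ) ≡ A₀ (if r then upper else lower) (column s x)
A₀-pattern r s x<s+2 with columnIndex s x<s+2
... | small-index {x} x<s rewrite dec-true (x ℕ.<? s) x<s
                                | dec-false (x ℕ.≟ s ℕ.+ 1) (ℕ.<⇒≢ (ℕ.<-≤-trans x<s (ℕ.m≤m+n s 1))) = by-half r
  where
  by-half : ∀ r → (if (r ∧ true) ∨ (not r ∧ false) then 0ℚ else 1ℚ) ≡ A₀ (if r then upper else lower) small
  by-half true  = refl
  by-half false = refl
... | fifth-index rewrite column-fifth s | dec-false (s ℕ.+ 0 ℕ.<? s) (ℕ.m+n≮m s 0)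
                        | dec-false (s ℕ.+ 0 ℕ.≟ s ℕ.+ 1) (λ eq → case ℕ.+-cancelˡ-≡ s 0 1 eq of λ ()) = by-half r
  where
  by-half : ∀ r → (if (r ∧ false) ∨ (not r ∧ false) then 0ℚ else 1ℚ) ≡ A₀ (if r then upper else lower) fifth
  by-half true  = refl
  by-half false = refl
... | twoFifths-index rewrite column-twoFifths s | dec-false (s ℕ.+ 1 ℕ.<? s) (ℕ.m+n≮m s 1)
                            | dec-true (s ℕ.+ 1 ℕ.≟ s ℕ.+ 1) refl = by-half r
  where
  by-half : ∀ r → (if (r ∧ false) ∨ (not r ∧ true) then 0ℚ else 1ℚ) ≡ A₀ (if r then upper else lower) twoFifths
  by-half true  = refl
  by-half false = refl

sumℕ-half : ∀ m (H : Half → ℚ) →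
  sumℕ (m ℕ.+ m) (λ x → H (half m x)) ≡ toℚ m * H upper + toℚ m * H lower
sumℕ-half m H = trans (sumℕ-+ m m (λ x → H (half m x))) (cong₂ _+_
  (sumℕ-const m (λ i i<m → cong H (half-upper i<m)))
  (sumℕ-const m (λ i _ → cong H (half-lower m i))))

sumℕ-column : ∀ s (H : Column → ℚ) →
  sumℕ (s ℕ.+ 2) (λ x → H (column s x)) ≡ toℚ s * H small + H fifth + H twoFifths
sumℕ-column s H = begin
  sumℕ (s ℕ.+ 2) (λ x → H (column s x))
    ≡⟨ sumℕ-+ s 2 (λ x → H (column s x)) ⟩
  sumℕ s (λ x → H (column s x)) + (H (column s (s ℕ.+ 0)) + (H (column s (s ℕ.+ 1)) + 0ℚ))
    ≡⟨ cong₂ _+_ (sumℕ-const s (λ i i<s → cong H (column-small i<s)))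
                 (cong₂ (λ c c' → H c + (H c' + 0ℚ)) (column-fifth s) (column-twoFifths s)) ⟩
  toℚ s * H small + (H fifth + (H twoFifths + 0ℚ))
    ≡⟨ cong (λ z → toℚ s * H small + (H fifth + z)) (ℚ.+-identityʳ (H twoFifths)) ⟩
  toℚ s * H small + (H fifth + H twoFifths)
    ≡⟨ sym (ℚ.+-assoc (toℚ s * H small) (H fifth) (H twoFifths)) ⟩
  toℚ s * H small + H fifth + H twoFifths ∎
  where open ≡-Reasoning

module Instance (t : ℕ) where

  halfRows smallCols : ℕ
  halfRows  = 5 *ℕ suc t
  smallCols = 4 *ℕ suc t

  ν : ℚ
  ν = + 1 / nOf t

  -- nOf t reduces to suc (t + 9 * suc t)
  ν≡mkℚ : ν ≡ mkℚ (+ 1) (t ℕ.+ 9 *ℕ suc t) (Coprime.1-coprimeTo (nOf t))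
  ν≡mkℚ = ℚ.↥p/↧p≡p (mkℚ (+ 1) (t ℕ.+ 9 *ℕ suc t) (Coprime.1-coprimeTo (nOf t)))

  0<ν : 0ℚ < ν
  0<ν = subst (0ℚ <_) (sym ν≡mkℚ) (positive⁻¹ _)

  n*ν≡1 : toℚ (nOf t) * ν ≡ 1ℚ
  n*ν≡1 rewrite toℚ-normal (nOf t) | ν≡mkℚ =
    ℚ.*-inverseʳ (mkℚ (+ nOf t) 0 (Coprime.sym (Coprime.1-coprimeTo (nOf t))))

  toℚ-*-ν : ∀ a b c → a *ℕ b ≡ c *ℕ nOf t → toℚ a * (toℚ b * ν) ≡ toℚ c
  toℚ-*-ν a b c ab≡cn = begin
    toℚ a * (toℚ b * ν)       ≡⟨ sym (ℚ.*-assoc (toℚ a) (toℚ b) ν) ⟩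
    toℚ a * toℚ b * ν         ≡⟨ cong (_* ν) (sym (toℚ-* a b)) ⟩
    toℚ (a *ℕ b) * ν          ≡⟨ cong (λ m → toℚ m * ν) ab≡cn ⟩
    toℚ (c *ℕ nOf t) * ν      ≡⟨ cong (_* ν) (toℚ-* c (nOf t)) ⟩
    toℚ c * toℚ (nOf t) * ν   ≡⟨ ℚ.*-assoc (toℚ c) (toℚ (nOf t)) ν ⟩
    toℚ c * (toℚ (nOf t) * ν) ≡⟨ cong (toℚ c *_) n*ν≡1 ⟩
    toℚ c * 1ℚ                ≡⟨ ℚ.*-identityʳ (toℚ c) ⟩
    toℚ c                     ∎
    where open ≡-Reasoning

  Nν≡½ : toℚ halfRows * ν ≡ + 1 / 2
  Nν≡½ = *-cancelʳ-≡ (toℚ halfRows * ν) (+ 1 / 2) {toℚ 2} (λ ())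
    (trans (ℚ.*-comm (toℚ halfRows * ν) (toℚ 2))
      (toℚ-*-ν 2 halfRows 1 (trans (sym (ℕ.*-assoc 2 5 (suc t))) (sym (ℕ.*-identityˡ (nOf t))))))

  Sν≡⅖ : toℚ smallCols * ν ≡ + 2 / 5
  Sν≡⅖ = *-cancelʳ-≡ (toℚ smallCols * ν) (+ 2 / 5) {toℚ 5} (λ ())
    (trans (ℚ.*-comm (toℚ smallCols * ν) (toℚ 5))
      (toℚ-*-ν 5 smallCols 2 (trans (sym (ℕ.*-assoc 5 4 (suc t))) (ℕ.*-assoc 2 10 (suc t)))))

  open Dynamics ν (toℚ halfRows) (toℚ smallCols) 0<ν Nν≡½ Sν≡⅖ (toℚ-mono-≤ (ℕ.m≤m*n 4 (suc t))) public

  row : Fin (nOf t) → Half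
  row i = half halfRows (toℕ i)

  col : Fin (colsOf t) → Column
  col j = column smallCols (toℕ j)

  sum-rows : ∀ H → sumFin (λ i → H (row i)) ≡ toℚ halfRows * H upper + toℚ halfRows * H lower
  sum-rows H = trans (sumFin-toℕ (nOf t) (λ x → H (half halfRows x)))
    (trans (cong (λ m → sumℕ m (λ x → H (half halfRows x))) (ℕ.*-distribʳ-+ (suc t) 5 5))
           (sumℕ-half halfRows H))

  sum-cols : ∀ H → sumFin (λ j → H (col j)) ≡ toℚ smallCols * H small + H fifth + H twoFifths
  sum-cols H = trans (sumFin-toℕ (colsOf t) (λ x → H (column smallCols x))) (sumℕ-column smallCols H)

  vVec-col : ∀ j → vVec t j ≡ vᴮ (col j)
  vVec-col j = vᴮ-column smallCols (toℕ j)

  open Expand row col sum-rows sum-cols {uVec t} {vVec t} (λ _ → refl) vVec-col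

  AMat≅A₀ : AMat t ≅ A₀
  AMat≅A₀ = blockwise λ i j → A₀-pattern (toℕ i <ᵇ halfRows) smallCols (FinP.toℕ<n j)

  skError-SK : ∀ k → skError (uVec t) (vVec t) (SK (uVec t) (vVec t) (AMat t) k) ≡ skErrorᴮ (SKᴮ A₀ k)
  skError-SK k = skError-≅ (SK-≅ AMat≅A₀ k)

theorem7p1 : ∃[ m ] ((t : ℕ) (ε : ℚ) → 0ℚ < ε → ε < + 1 / 10 → (k : ℕ)
    → skError (uVec t) (vVec t) (SK (uVec t) (vVec t) (AMat t) k) ≤ ε
    → + nOf t / 1 ≤ ε * (+ (2 ^ (suc m *ℕ k)) / 1))
theorem7p1 = 11 , bound
  where
  bound : (t : ℕ) (ε : ℚ) → 0ℚ < ε → ε < + 1 / 10 → (k : ℕ)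
    → skError (uVec t) (vVec t) (SK (uVec t) (vVec t) (AMat t) k) ≤ ε
    → toℚ (nOf t) ≤ ε * toℚ (2 ^ (12 *ℕ k))
  bound t ε 0<ε ε<⅒ zero err≤ε = ⊥-elim (<-irrefl refl
    (≤-<-trans (≤-trans initial-error (subst (_≤ ε) (skError-SK 0) err≤ε)) ε<⅒))
    where open Instance t
  bound t ε 0<ε ε<⅒ (suc k) err≤ε = begin
    toℚ (nOf t)                     ≤⟨ ≤-from-reciprocal (toℚ-nonNeg (nOf t)) n*ν≡1
                                         (SKᴮ-error-bound (suc k) ε<⅒ (subst (_≤ ε) (skError-SK (suc k)) err≤ε)) ⟩
    ε * toℚ (2 ^ (11 ℕ.+ suc k))    ≤⟨ *-monoˡ-≤ (<⇒≤ 0<ε) (toℚ-mono-≤ (ℕ.^-monoʳ-≤ 2 (12+k≤12*[1+k] k))) ⟩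
    ε * toℚ (2 ^ (12 *ℕ suc k))     ∎
    where
    open ℚ.≤-Reasoning
    open Instance t
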